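{- A permutation $\pi\in{\cal S}_n$ is bi-increasing if and only if \[\pi_k-k=|\{i>k:\pi_i<\pi_k\}|\ \text{ for every } k\in{\sf E}(\pi),\qquad k-\pi_k=|\{i<k:\pi_i>\pi_k\}|\ \text{ for every } k\in[n]\setminus{\sf E}(\pi).\]
   Context: Permutations $\pi\in{\cal S}_n$ are written as words $\pi_1\cdots\pi_n$ with $\pi_i=\pi(i)$. An excedance of $\pi$ is an integer $i\in[n-1]$ with $\pi_i>i$; ${\sf E}(\pi)$ denotes the set of excedances. The excedance difference is ${\sf dexc}(\pi)=\sum_{i\in{\sf E}(\pi)}(\pi_i-i)$, and ${\sf inv}(\pi)$ is the number of pairs $i<j$ with $\pi_i>\pi_j$. A permutation $\pi$ is called bi-increasing if ${\sf inv}(\pi)={\sf dexc}(\pi)$. -}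

module Defs where

open import Data.Nat using (ℕ; zero; suc; _+_; _∸_; _<_; _≤_)
open import Data.Nat.Properties using (_<?_)
open import Data.Fin using (Fin; toℕ)
open import Data.Fin.Permutation using (Permutation′; _⟨$⟩ʳ_)
open import Data.List using (List; filter; length; map; allFin)
open import Data.Nat.ListAction using (sum)
open import Relation.Binary.PropositionalEquality using (_≡_)
open import Data.Product using (_×_)
open import Relation.Nullary using (¬_)

-- Positions and values are 0-indexed via Fin n; the word π₁⋯πₙ of the paper
-- corresponds to π_{i+1} = toℕ (π ⟨$⟩ʳ i) + 1.  All quantities involved
-- (comparisons and differences) are invariant under this uniform shift.

val : ∀ {n} → Permutation′ n → Fin n → ℕ
val π i = toℕ (π ⟨$⟩ʳ i)

IsExc : ∀ {n} → Permutation′ n → Fin n → Set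
IsExc π i = toℕ i < val π i

excs : ∀ {n} → Permutation′ n → List (Fin n)
excs π = filter (λ i → toℕ i <? val π i) (allFin _)

dexc : ∀ {n} → Permutation′ n → ℕ
dexc π = sum (map (λ i → val π i ∸ toℕ i) (excs π))

inv : ∀ {n} → Permutation′ n → ℕ
inv {n} π = sum (map (λ i → length (filter (λ j → val π j <? val π i)
                                    (filter (λ j → toℕ i <? toℕ j) (allFin n))))
                     (allFin n))

BiIncreasing : ∀ {n} → Permutation′ n → Set
BiIncreasing π = inv π ≡ dexc π

rightSmaller : ∀ {n} → Permutation′ n → Fin n → ℕ
rightSmaller {n} π k =
  length (filter (λ i → val π i <? val π k) (filter (λ i → toℕ k <? toℕ i) (allFin n)))

leftLarger : ∀ {n} → Permutation′ n → Fin n → ℕ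
leftLarger {n} π k =
  length (filter (λ i → val π k <? val π i) (filter (λ i → toℕ i <? toℕ k) (allFin n)))

module Submission where

-- Let r_k, l_k be the counts in the statement and s_k = |{i < k : π_i < π_k}|.
-- Counting the values below π_k gives π_k - 1 = s_k + r_k, and counting the
-- positions before k gives k - 1 = s_k + l_k.  Hence r_k + k = l_k + π_k, so
-- r_k ≥ π_k ∸ k, and inv π = Σ r_k ≥ Σ (π_k ∸ k) = dexc π, with equality iff
-- r_k = π_k ∸ k for every k.  At a non-excedance this says r_k = 0, which by
-- the same identity is k - π_k = l_k.

open import Defs
open import Data.Nat using (ℕ; _∸_)
open import Data.Fin using (Fin; toℕ)
open import Data.Fin.Permutation using (Permutation′)
open import Data.Product using (_×_)
open import Function.Bundles using (_⇔_)
open import Relation.Nullary using (¬_)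
open import Relation.Binary.PropositionalEquality using (_≡_)

open import Data.Bool using (if_then_else_)
open import Data.Nat using (zero; suc; _+_; _*_; _<_; _≤_; z≤n; s≤s)
open import Data.Nat.Properties
open import Data.Fin using (zero; suc; punchIn)
open import Data.Fin.Properties using (toℕ-injective; toℕ<n)
open import Data.Fin.Permutation using (_⟨$⟩ʳ_; _⟨$⟩ˡ_; inverseˡ)
open import Data.List using (List; []; _∷_; filter; length; map; allFin; tabulate)
open import Data.Nat.ListAction using (sum)
open import Data.Product using (_,_)
open import Function.Base using (_∘_; id)
open import Function.Bundles using (mk⇔; Equivalence)
open import Function.Properties.Equivalence using () renaming (trans to ⇔-trans)
open import Relation.Nullary using (Dec; does; yes; no; contradiction)
open import Relation.Unary using (Pred; Decidable)
open import Relation.Binary.PropositionalEquality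
  using (_≢_; refl; sym; trans; cong; cong₂; module ≡-Reasoning)
open import Algebra.Properties.CommutativeMonoid.Sum +-0-commutativeMonoid
  using (sum-syntax; sum-cong-≗; ∑-distrib-+; sum-permute; sum-remove; sum-replicate-zero)
  renaming (sum to ∑)
open import Algebra.Properties.CommutativeSemigroup +-commutativeSemigroup using (x∙yz≈z∙yx)

χ : ∀ {a} {A : Set a} → Dec A → ℕ
χ a? = if does a? then 1 else 0

χ-split : ∀ {a} {A : Set a} {p q : ℕ} (a? : Dec A) (p<?q : Dec (p < q)) (q<?p : Dec (q < p)) →
          (A → p ≢ q) → χ a? ≡ χ p<?q * χ a? + χ q<?p * χ a?
χ-split (no _)  p<?q      q<?p      _   = sym (cong₂ _+_ (*-zeroʳ (χ p<?q)) (*-zeroʳ (χ q<?p)))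
χ-split (yes _) (yes p<q) (yes q<p) _   = contradiction q<p (<-asym p<q)
χ-split (yes _) (yes _)   (no _)    _   = refl
χ-split (yes _) (no _)    (yes _)   _   = refl
χ-split (yes a) (no p≮q)  (no q≮p)  p≢q = contradiction (≤-antisym (≮⇒≥ q≮p) (≮⇒≥ p≮q)) (p≢q a)

module _ {a p} {A : Set a} {P : Pred A p} (P? : Decidable P) where

  sum-map-filter : (f : A → ℕ) (xs : List A) →
                   sum (map f (filter P? xs)) ≡ sum (map (λ x → χ (P? x) * f x) xs)
  sum-map-filter f [] = refl
  sum-map-filter f (x ∷ xs) with P? x
  ... | yes _ = cong₂ _+_ (sym (+-identityʳ (f x))) (sum-map-filter f xs)
  ... | no _  = sum-map-filter f xs

  length-filter≡sum : (xs : List A) → length (filter P? xs) ≡ sum (map (χ ∘ P?) xs)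
  length-filter≡sum [] = refl
  length-filter≡sum (x ∷ xs) with P? x
  ... | yes _ = cong suc (length-filter≡sum xs)
  ... | no _  = length-filter≡sum xs

length-filter-filter≡sum : ∀ {a p q} {A : Set a} {P : Pred A p} {Q : Pred A q}
                           (P? : Decidable P) (Q? : Decidable Q) (xs : List A) →
                           length (filter Q? (filter P? xs)) ≡ sum (map (λ x → χ (P? x) * χ (Q? x)) xs)
length-filter-filter≡sum P? Q? xs =
  trans (length-filter≡sum Q? (filter P? xs)) (sum-map-filter P? (χ ∘ Q?) xs)

sum-map-tabulate : ∀ {n} {A : Set} (f : A → ℕ) (g : Fin n → A) →
                   sum (map f (tabulate g)) ≡ ∑[ i < n ] f (g i)
sum-map-tabulate {zero}  f g = refl
sum-map-tabulate {suc n} f g = cong (f (g zero) +_) (sum-map-tabulate f (g ∘ suc))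

sum-map-allFin : ∀ {n} (f : Fin n → ℕ) → sum (map f (allFin n)) ≡ ∑[ i < n ] f i
sum-map-allFin f = sum-map-tabulate f id

∑-mono-≤ : ∀ {n} {f g : Fin n → ℕ} → (∀ i → f i ≤ g i) → ∑[ i < n ] f i ≤ ∑[ i < n ] g i
∑-mono-≤ {zero}  _   = z≤n
∑-mono-≤ {suc n} f≤g = +-mono-≤ (f≤g zero) (∑-mono-≤ (f≤g ∘ suc))

∑-mono-≤-≡⇒≗ : ∀ {n} {f g : Fin n → ℕ} → (∀ i → f i ≤ g i) →
               ∑[ i < n ] f i ≡ ∑[ i < n ] g i → ∀ i → f i ≡ g i
∑-mono-≤-≡⇒≗ {suc n} {f} {g} f≤g ∑f≡∑g i =
  ≤-antisym (f≤g i) (+-cancelʳ-≤ (∑ (f ∘ punchIn i)) (g i) (f i) (begin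
    g i + ∑ (f ∘ punchIn i) ≤⟨ +-monoʳ-≤ (g i) (∑-mono-≤ (f≤g ∘ punchIn i)) ⟩
    g i + ∑ (g ∘ punchIn i) ≡⟨ sum-remove g ⟨
    ∑ g                     ≡⟨ ∑f≡∑g ⟨
    ∑ f                     ≡⟨ sum-remove f ⟩
    f i + ∑ (f ∘ punchIn i) ∎))
  where open ≤-Reasoning

∑-χ-below : ∀ n m → m ≤ n → ∑[ i < n ] χ (toℕ i <? m) ≡ m
∑-χ-below zero    zero    _         = refl
∑-χ-below (suc n) zero    _         = sum-replicate-zero n
∑-χ-below (suc n) (suc m) (s≤s m≤n) = cong suc (∑-χ-below n m m≤n)

χ<*∸≡∸ : ∀ {m n} (m<?n : Dec (m < n)) → χ m<?n * (n ∸ m) ≡ n ∸ m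
χ<*∸≡∸ {m} {n} (yes _)  = *-identityˡ (n ∸ m)
χ<*∸≡∸         (no m≮n) = sym (m≤n⇒m∸n≡0 (≮⇒≥ m≮n))

m+n≡o+p⇒p∸n≤m : ∀ m n o p → m + n ≡ o + p → p ∸ n ≤ m
m+n≡o+p⇒p∸n≤m m n o p eq = m≤n+o⇒m∸n≤o p n (begin
  p     ≤⟨ m≤n+m p o ⟩
  o + p ≡⟨ eq ⟨
  m + n ≡⟨ +-comm m n ⟩
  n + m ∎)
  where open ≤-Reasoning

m+n≡o+p∧p≤n⇒[n∸p≡o⇔m≡0] : ∀ m n o p → m + n ≡ o + p → p ≤ n → (n ∸ p ≡ o) ⇔ (m ≡ 0)
m+n≡o+p∧p≤n⇒[n∸p≡o⇔m≡0] m n o p eq p≤n = mk⇔ to from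
  where
  to : n ∸ p ≡ o → m ≡ 0
  to n∸p≡o = +-cancelʳ-≡ n m 0 (begin
    m + n         ≡⟨ eq ⟩
    o + p         ≡⟨ cong (_+ p) n∸p≡o ⟨
    n ∸ p + p     ≡⟨ m∸n+n≡m p≤n ⟩
    n             ∎)
    where open ≡-Reasoning
  from : m ≡ 0 → n ∸ p ≡ o
  from refl = trans (cong (_∸ p) eq) (m+n∸n≡m o p)

module _ {n : ℕ} (π : Permutation′ n) where

  val-injective : ∀ {i k} → val π i ≡ val π k → i ≡ k
  val-injective {i} {k} vi≡vk = begin
    i                          ≡⟨ inverseˡ π ⟨
    π ⟨$⟩ˡ (π ⟨$⟩ʳ i)          ≡⟨ cong (π ⟨$⟩ˡ_) (toℕ-injective vi≡vk) ⟩
    π ⟨$⟩ˡ (π ⟨$⟩ʳ k)          ≡⟨ inverseˡ π ⟩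
    k                          ∎
    where open ≡-Reasoning

  leftSmaller : Fin n → ℕ
  leftSmaller k = ∑[ i < n ] (χ (toℕ i <? toℕ k) * χ (val π i <? val π k))

  rightSmaller≡∑ : ∀ k → rightSmaller π k ≡ ∑[ i < n ] (χ (toℕ k <? toℕ i) * χ (val π i <? val π k))
  rightSmaller≡∑ k =
    trans (length-filter-filter≡sum (λ i → toℕ k <? toℕ i) (λ i → val π i <? val π k) (allFin n))
          (sum-map-allFin {n} _)

  leftLarger≡∑ : ∀ k → leftLarger π k ≡ ∑[ i < n ] (χ (toℕ i <? toℕ k) * χ (val π k <? val π i))
  leftLarger≡∑ k =
    trans (length-filter-filter≡sum (λ i → toℕ i <? toℕ k) (λ i → val π k <? val π i) (allFin n))
          (sum-map-allFin {n} _)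

  ∑-χ-val< : ∀ k → ∑[ i < n ] χ (val π i <? val π k) ≡ val π k
  ∑-χ-val< k = trans (sym (sum-permute (λ j → χ (toℕ j <? val π k)) π))
                     (∑-χ-below n (val π k) (<⇒≤ (toℕ<n (π ⟨$⟩ʳ k))))

  val≡leftSmaller+rightSmaller : ∀ k → val π k ≡ leftSmaller k + rightSmaller π k
  val≡leftSmaller+rightSmaller k = begin
    val π k
      ≡⟨ ∑-χ-val< k ⟨
    ∑[ i < n ] χ (val π i <? val π k)
      ≡⟨ sum-cong-≗ (λ i → χ-split (val π i <? val π k) (toℕ i <? toℕ k) (toℕ k <? toℕ i)
                              (λ vi<vk i≡k → <-irrefl (cong (val π) (toℕ-injective i≡k)) vi<vk)) ⟩
    ∑[ i < n ] (χ (toℕ i <? toℕ k) * χ (val π i <? val π k) + χ (toℕ k <? toℕ i) * χ (val π i <? val π k))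
      ≡⟨ ∑-distrib-+ (λ i → χ (toℕ i <? toℕ k) * χ (val π i <? val π k))
                     (λ i → χ (toℕ k <? toℕ i) * χ (val π i <? val π k)) ⟩
    leftSmaller k + ∑[ i < n ] (χ (toℕ k <? toℕ i) * χ (val π i <? val π k))
      ≡⟨ cong (leftSmaller k +_) (rightSmaller≡∑ k) ⟨
    leftSmaller k + rightSmaller π k
      ∎
    where open ≡-Reasoning

  toℕ≡leftSmaller+leftLarger : ∀ k → toℕ k ≡ leftSmaller k + leftLarger π k
  toℕ≡leftSmaller+leftLarger k = begin
    toℕ k
      ≡⟨ ∑-χ-below n (toℕ k) (<⇒≤ (toℕ<n k)) ⟨
    ∑[ i < n ] χ (toℕ i <? toℕ k)
      ≡⟨ sum-cong-≗ (λ i → split i) ⟩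
    ∑[ i < n ] (χ (toℕ i <? toℕ k) * χ (val π i <? val π k) + χ (toℕ i <? toℕ k) * χ (val π k <? val π i))
      ≡⟨ ∑-distrib-+ (λ i → χ (toℕ i <? toℕ k) * χ (val π i <? val π k))
                     (λ i → χ (toℕ i <? toℕ k) * χ (val π k <? val π i)) ⟩
    leftSmaller k + ∑[ i < n ] (χ (toℕ i <? toℕ k) * χ (val π k <? val π i))
      ≡⟨ cong (leftSmaller k +_) (leftLarger≡∑ k) ⟨
    leftSmaller k + leftLarger π k
      ∎
    where
    open ≡-Reasoning
    split : ∀ i → χ (toℕ i <? toℕ k) ≡ χ (toℕ i <? toℕ k) * χ (val π i <? val π k)
                                       + χ (toℕ i <? toℕ k) * χ (val π k <? val π i)
    split i = trans (χ-split (toℕ i <? toℕ k) (val π i <? val π k) (val π k <? val π i)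
                             (λ i<k vi≡vk → <-irrefl (cong toℕ (val-injective vi≡vk)) i<k))
                    (cong₂ _+_ (*-comm (χ (val π i <? val π k)) (χ (toℕ i <? toℕ k)))
                               (*-comm (χ (val π k <? val π i)) (χ (toℕ i <? toℕ k))))

  rightSmaller+toℕ≡leftLarger+val : ∀ k → rightSmaller π k + toℕ k ≡ leftLarger π k + val π k
  rightSmaller+toℕ≡leftLarger+val k = begin
    rightSmaller π k + toℕ k
      ≡⟨ cong (rightSmaller π k +_) (toℕ≡leftSmaller+leftLarger k) ⟩
    rightSmaller π k + (leftSmaller k + leftLarger π k)
      ≡⟨ x∙yz≈z∙yx (rightSmaller π k) (leftSmaller k) (leftLarger π k) ⟩
    leftLarger π k + (leftSmaller k + rightSmaller π k)
      ≡⟨ cong (leftLarger π k +_) (val≡leftSmaller+rightSmaller k) ⟨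
    leftLarger π k + val π k
      ∎
    where open ≡-Reasoning

  ∸≤rightSmaller : ∀ k → val π k ∸ toℕ k ≤ rightSmaller π k
  ∸≤rightSmaller k = m+n≡o+p⇒p∸n≤m _ _ _ _ (rightSmaller+toℕ≡leftLarger+val k)

  inv≡∑rightSmaller : inv π ≡ ∑[ k < n ] rightSmaller π k
  inv≡∑rightSmaller = sum-map-allFin (rightSmaller π)

  dexc≡∑∸ : dexc π ≡ ∑[ k < n ] (val π k ∸ toℕ k)
  dexc≡∑∸ = begin
    dexc π
      ≡⟨ sum-map-filter (λ k → toℕ k <? val π k) d (allFin n) ⟩
    sum (map (λ k → χ (toℕ k <? val π k) * d k) (allFin n))
      ≡⟨ sum-map-allFin {n} _ ⟩
    ∑[ k < n ] (χ (toℕ k <? val π k) * d k)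
      ≡⟨ sum-cong-≗ (λ k → χ<*∸≡∸ (toℕ k <? val π k)) ⟩
    ∑[ k < n ] d k
      ∎
    where
    open ≡-Reasoning
    d : Fin n → ℕ
    d k = val π k ∸ toℕ k

  biIncreasing⇔rightSmaller≗∸ : BiIncreasing π ⇔ (∀ k → rightSmaller π k ≡ val π k ∸ toℕ k)
  biIncreasing⇔rightSmaller≗∸ = mk⇔
    (λ inv≡dexc → sym ∘ ∑-mono-≤-≡⇒≗ ∸≤rightSmaller
                          (sym (trans (sym inv≡∑rightSmaller) (trans inv≡dexc dexc≡∑∸))))
    (λ rightSmaller≗∸ → trans inv≡∑rightSmaller (trans (sum-cong-≗ rightSmaller≗∸) (sym dexc≡∑∸)))

  rightSmaller≗∸⇔conditions :
    (∀ k → rightSmaller π k ≡ val π k ∸ toℕ k) ⇔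
      (((k : Fin n) → IsExc π k → val π k ∸ toℕ k ≡ rightSmaller π k)
       × ((k : Fin n) → ¬ IsExc π k → toℕ k ∸ val π k ≡ leftLarger π k))
  rightSmaller≗∸⇔conditions = mk⇔
    (λ rightSmaller≗∸ →
      (λ k _ → sym (rightSmaller≗∸ k)) ,
      (λ k k≮v → Equivalence.from (non-excedance k k≮v)
                                   (trans (rightSmaller≗∸ k) (m≤n⇒m∸n≡0 (≮⇒≥ k≮v)))))
    (λ (exc , non-exc) k → rightSmaller≡∸-by-cases k (toℕ k <? val π k) (exc k) (non-exc k))
    where
    non-excedance : ∀ k → ¬ IsExc π k → (toℕ k ∸ val π k ≡ leftLarger π k) ⇔ (rightSmaller π k ≡ 0)
    non-excedance k k≮v =
      m+n≡o+p∧p≤n⇒[n∸p≡o⇔m≡0] _ _ _ _ (rightSmaller+toℕ≡leftLarger+val k) (≮⇒≥ k≮v)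
    rightSmaller≡∸-by-cases : ∀ k → Dec (IsExc π k) →
      (IsExc π k → val π k ∸ toℕ k ≡ rightSmaller π k) →
      (¬ IsExc π k → toℕ k ∸ val π k ≡ leftLarger π k) → rightSmaller π k ≡ val π k ∸ toℕ k
    rightSmaller≡∸-by-cases k (yes k<v) exc _       = sym (exc k<v)
    rightSmaller≡∸-by-cases k (no k≮v)  _   non-exc =
      trans (Equivalence.to (non-excedance k k≮v) (non-exc k≮v)) (sym (m≤n⇒m∸n≡0 (≮⇒≥ k≮v)))

proposition2p1 : (n : ℕ) (π : Permutation′ n) →
    BiIncreasing π ⇔
      (((k : Fin n) → IsExc π k → val π k ∸ toℕ k ≡ rightSmaller π k)
       × ((k : Fin n) → ¬ IsExc π k → toℕ k ∸ val π k ≡ leftLarger π k))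
proposition2p1 n π = ⇔-trans (biIncreasing⇔rightSmaller≗∸ π) (rightSmaller≗∸⇔conditions π)
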